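{- Let $m$ be a positive integer and $q=2^m$. Let $u\in\mathbb{F}_q$ with $\mathrm{Tr}_2^q(u)=1$, let $\alpha\in\mathbb{F}_{q^2}$ be a root of $x^2+x+u$ (so $\{1,\alpha\}$ is a basis of $\mathbb{F}_{q^2}$ over $\mathbb{F}_q$), and let $\delta,\gamma\in\mathbb{F}_{q^2}$ with $\gamma\neq0$, written as $\delta=a+b\alpha$, $\gamma=c+d\alpha$ with $a,b,c,d\in\mathbb{F}_q$ (so that $\mathrm{Tr}_q^{q^2}(\delta)=b$, $\mathrm{Tr}_q^{q^2}(\gamma)=d$, $\mathrm{N}_q^{q^2}(\delta)=a^2+ab+b^2u$, $\mathrm{N}_q^{q^2}(\gamma)=c^2+cd+d^2u$). Then the polynomial $$f(x)=(x^q+x+\delta)^{2q+1}+\gamma x$$ is a permutation polynomial of $\mathbb{F}_{q^2}$ if and only if one of the following holds: (i) $\gamma\in\mathbb{F}_q^*$, and $b=0$ or $b^2=\gamma$; (ii) $\gamma\in\mathbb{F}_{q^2}^*\setminus\mathbb{F}_q$, $c=0$, $b^2u+b^2+du=0$ and $m$ is odd; (iii) $\gamma\in\mathbb{F}_{q^2}^*\setminus\mathbb{F}_q$, $c\neq0$, $b^2c^2+d\left(b^2(c+d+du)+c^2+cd+d^2u\right)=0$ and $m$ is odd.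
   Context: A polynomial over a finite field $\mathbb{F}$ is a permutation polynomial of $\mathbb{F}$ if the map it induces on $\mathbb{F}$ is a bijection. $\mathrm{Tr}_2^q(u)=u+u^2+u^{2^2}+\cdots+u^{2^{m-1}}$ for $u\in\mathbb{F}_q$; for $x\in\mathbb{F}_{q^2}$, $\mathrm{Tr}_q^{q^2}(x)=x+x^q$ and $\mathrm{N}_q^{q^2}(x)=x^{q+1}$. -}

module Defs where

open import Level using (0ℓ)
open import Data.Nat using (ℕ; zero; suc) renaming (_^_ to _^ℕ_; _*_ to _*ℕ_)
open import Data.Fin using (Fin)
open import Relation.Binary.PropositionalEquality using (_≡_)
open import Relation.Nullary using (¬_)
open import Data.Product using (Σ; _×_)
open import Function.Bundles using (_↔_)
open import Function.Definitions using (Bijective)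
open import Algebra.Core using (Op₁; Op₂)
import Algebra.Structures as S

record Field : Set₁ where
  infixl 6 _+_
  infixl 7 _*_
  field
    Carrier : Set
    _+_ _*_ : Op₂ Carrier
    -_      : Op₁ Carrier
    0# 1#   : Carrier
    isCommutativeRing : S.IsCommutativeRing {A = Carrier} _≡_ _+_ _*_ -_ 0# 1#
    0≢1     : ¬ (0# ≡ 1#)
    inverse : (x : Carrier) → ¬ (x ≡ 0#) → Σ Carrier (λ y → x * y ≡ 1#)

  _^_ : Carrier → ℕ → Carrier
  x ^ zero  = 1#
  x ^ suc n = x * (x ^ n)

record FieldOfOrder (n : ℕ) : Set₁ where
  field
    field' : Field
  open Field field' public
  field
    enumeration : Carrier ↔ Fin n

module FieldNotation {n : ℕ} (F : FieldOfOrder n) where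
  open FieldOfOrder F public

  InSubfield : (q : ℕ) → Carrier → Set
  InSubfield q x = x ^ q ≡ x

  traceTo2 : ℕ → Carrier → Carrier
  traceTo2 zero    u = 0#
  traceTo2 (suc k) u = traceTo2 k u + u ^ (2 ^ℕ k)

  IsPermutation : (Carrier → Carrier) → Set
  IsPermutation f = Bijective _≡_ _≡_ f

{-# OPTIONS --safe #-}
module Submission where

-- Write Tr x = x ^ q + x and Nm x = x ^ (q + 1).  Then f x = H (Tr x) + γ x with
-- H t = (t + δ) ^ (2q + 1), and the trace of γ^q (f x + f x′) is G (Tr x) + G (Tr x′) for
-- G s = Nm γ · s + Tr (γ^q · H s).  Hence f permutes 𝔽_{q²} iff G is injective on 𝔽_q; a
-- collision of G lifts to one of f because Tr (s α) = s.  For Y = s + δ one has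
-- Tr (γ^q Y^q Y^q Y) = Nm Y · Tr (γ Y), and in the basis {1, α} this makes G, up to the shift
-- s ↦ s + a and a constant, the cubic d y³ + b c y² + (b² (c + d + d u) + Nm γ) y.
-- If d = 0, i.e. γ ∈ 𝔽_q, it is c (b y² + (b² + c) y), an additive map whose kernel in 𝔽_q is
-- trivial iff b = 0 or b² = c.  If d ≠ 0, the substitution r = d y + b c turns it into r³ + K r
-- with K the expression of the theorem.  This is injective on 𝔽_q iff K = 0 (otherwise √K and
-- 0 collide) and 𝔽_q contains no cube root of unity w ≠ 1.  Such a w satisfies w² + w = 1, so
-- telescoping gives Tr_2^q (1) = 0, i.e. m is even; for even m one is built from u.

open import Defs
open import Data.Nat using (ℕ; NonZero; _%_) renaming (_^_ to _^ℕ_; _*_ to _*ℕ_; _+_ to _+ℕ_)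
open import Relation.Binary.PropositionalEquality using (_≡_)
open import Relation.Nullary using (¬_)
open import Data.Product using (_×_)
open import Data.Sum using (_⊎_)
open import Function.Bundles using (_⇔_)

open import Level using (0ℓ)
open import Algebra.Bundles using (CommutativeRing; RawRing)
open import Algebra.Solver.Ring.AlmostCommutativeRing
  using (fromCommutativeRing; _-Raw-AlmostCommutative⟶_; Induced-equivalence)
open import Data.Bool using (Bool; true; false)
open import Data.Bool.Properties using (xor-∧-commutativeRing)
open import Data.Empty using (⊥-elim; ⊥-elim-irr)
open import Data.Fin as Fin using (Fin; punchOut)
import Data.Fin.Properties as Finₚ
open import Data.Fin.Permutation using (Permutation)
open import Data.Maybe using (just; nothing)
open import Data.Nat using (zero; suc)
import Data.Nat.Properties as ℕ
open import Data.Product using (_,_; proj₁; proj₂)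
open import Data.Sum as Sum using (inj₁; inj₂)
open import Data.Vec.Functional using (removeAt)
open import Function.Base using (_∘_)
open import Function.Bundles using (_↔_; Inverse; Injection; Equivalence; mk⇔; mk↔ₛ′)
open import Function.Consequences.Propositional using (strictlySurjective⇒surjective)
open import Function.Construct.Composition using (_↔-∘_)
open import Function.Construct.Symmetry using (↔-sym; ⇔-sym)
open import Function.Definitions using (Injective; Bijective; StrictlySurjective)
open import Function.Properties.Equivalence using (⇔-isEquivalence)
open import Function.Properties.Inverse using (↔⇒↣)
import Function.Related.Propositional as Related
open import Relation.Binary.Definitions using (DecidableEquality; WeaklyDecidable)
open import Relation.Binary.PropositionalEquality
  using (_≢_; refl; sym; trans; cong; cong₂; subst; module ≡-Reasoning)
open import Relation.Binary.Structures using (IsEquivalence)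
open import Relation.Nullary using (yes; no; contradiction)
open import Relation.Nullary.Decidable as Dec using (decidable-stable)

open IsEquivalence (⇔-isEquivalence {0ℓ}) using () renaming (trans to ⇔-trans)

InjectiveOn : {A B : Set} → (A → Set) → (A → B) → Set
InjectiveOn P g = ∀ {x y} → P x → P y → g x ≡ g y → x ≡ y

m%2≡0⊎m%2≡1 : ∀ m → m % 2 ≡ 0 ⊎ m % 2 ≡ 1
m%2≡0⊎m%2≡1 zero          = inj₁ refl
m%2≡0⊎m%2≡1 (suc zero)    = inj₂ refl
m%2≡0⊎m%2≡1 (suc (suc m)) = m%2≡0⊎m%2≡1 m

Fin-injective⇒strictlySurjective : ∀ {n} (f : Fin n → Fin n) → Injective _≡_ _≡_ f → StrictlySurjective _≡_ f
Fin-injective⇒strictlySurjective f f-inj y with Finₚ.any? (λ x → f x Finₚ.≟ y)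
... | yes hit = hit
Fin-injective⇒strictlySurjective {suc n} f f-inj y | no miss =
  contradiction (Finₚ.injective⇒≤ punchOut-injective) (ℕ.<-irrefl refl)
  where
  y≢f : ∀ x → y ≢ f x
  y≢f x y≡fx = miss (x , sym y≡fx)
  punchOut-injective : Injective _≡_ _≡_ (λ x → punchOut (y≢f x))
  punchOut-injective eq = f-inj (Finₚ.punchOut-injective (y≢f _) (y≢f _) eq)

finite-injective⇒bijective : ∀ {A : Set} {n} → A ↔ Fin n → (f : A → A) →
                             Injective _≡_ _≡_ f → Bijective _≡_ _≡_ f
finite-injective⇒bijective enum f f-inj = f-inj , strictlySurjective⇒surjective preimage
  where
  open Inverse enum using (to; from; strictlyInverseʳ)
  preimage : StrictlySurjective _≡_ f
  preimage y with Fin-injective⇒strictlySurjective (to ∘ f ∘ from)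
                    (Injection.injective (↔⇒↣ (↔-sym enum)) ∘ f-inj ∘ Injection.injective (↔⇒↣ enum)) (to y)
  ... | i , eq = from i , trans (sym (strictlyInverseʳ _)) (trans (cong from eq) (strictlyInverseʳ y))

module FieldProperties (F : Field) where
  open Field F

  commutativeRing : CommutativeRing 0ℓ 0ℓ
  commutativeRing = record { isCommutativeRing = isCommutativeRing }

  open CommutativeRing commutativeRing public
    using ( +-assoc; +-comm; +-identityˡ; +-identityʳ; -‿inverseˡ; -‿inverseʳ
          ; *-assoc; *-comm; *-identityˡ; *-identityʳ; zeroˡ; zeroʳ; distribˡ )
  open CommutativeRing commutativeRing using (+-group; ring; commutativeSemiring)
  open import Algebra.Properties.Group +-group public
    using () renaming (∙-cancelˡ to +-cancelˡ; ∙-cancelʳ to +-cancelʳ)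
  open import Algebra.Properties.Group +-group using (⁻¹-involutive)
  open import Algebra.Properties.Ring ring using (-1*x≈-x)
  import Algebra.Properties.CommutativeSemiring.Exp commutativeSemiring as Exp
  open ≡-Reasoning

  inv : (x : Carrier) → x ≢ 0# → Carrier
  inv x x≢0 = proj₁ (inverse x x≢0)

  *-inv : ∀ {x} (x≢0 : x ≢ 0#) → x * inv x x≢0 ≡ 1#
  *-inv {x} x≢0 = proj₂ (inverse x x≢0)

  inv-cancelˡ : ∀ {x} (x≢0 : x ≢ 0#) y → inv x x≢0 * (x * y) ≡ y
  inv-cancelˡ {x} x≢0 y = begin
    inv x x≢0 * (x * y)  ≡⟨ *-assoc (inv x x≢0) x y ⟨
    inv x x≢0 * x * y    ≡⟨ cong (_* y) (trans (*-comm (inv x x≢0) x) (*-inv x≢0)) ⟩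
    1# * y               ≡⟨ *-identityˡ y ⟩
    y                    ∎

  inv-cancelʳ : ∀ {x} (x≢0 : x ≢ 0#) y → x * (inv x x≢0 * y) ≡ y
  inv-cancelʳ {x} x≢0 y = begin
    x * (inv x x≢0 * y)  ≡⟨ *-assoc x (inv x x≢0) y ⟨
    x * inv x x≢0 * y    ≡⟨ cong (_* y) (*-inv x≢0) ⟩
    1# * y               ≡⟨ *-identityˡ y ⟩
    y                    ∎

  *-cancelˡ : ∀ {x y z} → x ≢ 0# → x * y ≡ x * z → y ≡ z
  *-cancelˡ {x} {y} {z} x≢0 eq = begin
    y                    ≡⟨ inv-cancelˡ x≢0 y ⟨
    inv x x≢0 * (x * y)  ≡⟨ cong (inv x x≢0 *_) eq ⟩
    inv x x≢0 * (x * z)  ≡⟨ inv-cancelˡ x≢0 z ⟩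
    z                    ∎

  *≡0⇒≡0 : ∀ {x y} → x ≢ 0# → x * y ≡ 0# → y ≡ 0#
  *≡0⇒≡0 {x} x≢0 eq = *-cancelˡ x≢0 (trans eq (sym (zeroʳ x)))

  *-≢0 : ∀ {x y} → x ≢ 0# → y ≢ 0# → x * y ≢ 0#
  *-≢0 x≢0 y≢0 eq = y≢0 (*≡0⇒≡0 x≢0 eq)

  ^-≢0 : ∀ {x} n → x ≢ 0# → x ^ n ≢ 0#
  ^-≢0 zero    x≢0 eq = 0≢1 (sym eq)
  ^-≢0 (suc n) x≢0    = *-≢0 x≢0 (^-≢0 n x≢0)

  inv-≢0 : ∀ {x} (x≢0 : x ≢ 0#) → inv x x≢0 ≢ 0#
  inv-≢0 {x} x≢0 x⁻¹≡0 = 0≢1 (trans (sym (zeroʳ x)) (trans (cong (x *_) (sym x⁻¹≡0)) (*-inv x≢0)))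

  *-↔ : ∀ {x} → x ≢ 0# → Carrier ↔ Carrier
  *-↔ {x} x≢0 = mk↔ₛ′ (x *_) (inv x x≢0 *_) (inv-cancelʳ x≢0) (inv-cancelˡ x≢0)

  ^≡Exp^ : ∀ x n → x ^ n ≡ x Exp.^ n
  ^≡Exp^ x zero    = refl
  ^≡Exp^ x (suc n) = cong (x *_) (^≡Exp^ x n)

  ^-homo-* : ∀ x m n → x ^ (m +ℕ n) ≡ x ^ m * x ^ n
  ^-homo-* x m n = trans (^≡Exp^ x (m +ℕ n))
    (trans (Exp.^-homo-* x m n) (sym (cong₂ _*_ (^≡Exp^ x m) (^≡Exp^ x n))))

  ^-assocʳ : ∀ x m n → (x ^ m) ^ n ≡ x ^ (m *ℕ n)
  ^-assocʳ x m n = trans (^≡Exp^ (x ^ m) n) (trans (cong (Exp._^ n) (^≡Exp^ x m))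
    (trans (Exp.^-assocʳ x m n) (sym (^≡Exp^ x (m *ℕ n)))))

  ^-distrib-* : ∀ x y n → (x * y) ^ n ≡ x ^ n * y ^ n
  ^-distrib-* x y n = trans (^≡Exp^ (x * y) n)
    (trans (Exp.^-distrib-* x y n) (sym (cong₂ _*_ (^≡Exp^ x n) (^≡Exp^ y n))))

  ^-double : ∀ x n → x ^ (2 *ℕ n) ≡ x ^ n * x ^ n
  ^-double x n = trans (^-homo-* x n (n +ℕ 0)) (cong (λ k → x ^ n * x ^ k) (ℕ.+-identityʳ n))

  ^-2n+1 : ∀ x n → x ^ (2 *ℕ n +ℕ 1) ≡ x ^ n * x ^ n * x
  ^-2n+1 x n = trans (^-homo-* x (2 *ℕ n) 1) (cong₂ _*_ (^-double x n) (*-identityʳ x))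

  1^n≡1 : ∀ n → 1# ^ n ≡ 1#
  1^n≡1 zero    = refl
  1^n≡1 (suc n) = trans (*-identityˡ _) (1^n≡1 n)

  -1^2≡1 : (- 1#) ^ 2 ≡ 1#
  -1^2≡1 = trans (cong (- 1# *_) (*-identityʳ (- 1#))) (trans (-1*x≈-x (- 1#)) (⁻¹-involutive 1#))

  InjectiveOn-cong : ∀ {P : Carrier → Set} {g h : Carrier → Carrier} →
                     (∀ {x} → P x → g x ≡ h x) → InjectiveOn P g → InjectiveOn P h
  InjectiveOn-cong g≡h g-inj {x} {y} x∈P y∈P hx≡hy =
    g-inj x∈P y∈P (trans (g≡h {x} x∈P) (trans hx≡hy (sym (g≡h {y} y∈P))))

  InjectiveOn-cong⇔ : ∀ {P : Carrier → Set} {g h : Carrier → Carrier} →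
                      (∀ {x} → P x → g x ≡ h x) → InjectiveOn P g ⇔ InjectiveOn P h
  InjectiveOn-cong⇔ g≡h = mk⇔ (InjectiveOn-cong g≡h) (InjectiveOn-cong (sym ∘ g≡h))

  InjectiveOn-+ʳ : ∀ {P : Carrier → Set} g e → InjectiveOn P (λ x → g x + e) ⇔ InjectiveOn P g
  InjectiveOn-+ʳ g e = mk⇔
    (λ inj {_} {_} x∈P y∈P eq → inj x∈P y∈P (cong (_+ e) eq))
    (λ inj {_} {_} x∈P y∈P eq → inj x∈P y∈P (+-cancelʳ e _ _ eq))

  InjectiveOn-*ˡ : ∀ {P : Carrier → Set} g {k} → k ≢ 0# → InjectiveOn P (λ x → k * g x) ⇔ InjectiveOn P g
  InjectiveOn-*ˡ g k≢0 = mk⇔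
    (λ inj {_} {_} x∈P y∈P eq → inj x∈P y∈P (cong (_ *_) eq))
    (λ inj {_} {_} x∈P y∈P eq → inj x∈P y∈P (*-cancelˡ k≢0 eq))

module CharacteristicTwo (F : Field) (1+1≡0 : Field._+_ F (Field.1# F) (Field.1# F) ≡ Field.0# F) where
  open Field F
  open FieldProperties F
  open ≡-Reasoning

  -1≡1 : - 1# ≡ 1#
  -1≡1 = +-cancelʳ 1# (- 1#) 1# (trans (-‿inverseˡ 1#) (sym 1+1≡0))

  -0≡0 : - 0# ≡ 0#
  -0≡0 = trans (sym (+-identityˡ (- 0#))) (-‿inverseʳ 0#)

  ⟦_⟧₂ : Bool → Carrier
  ⟦ false ⟧₂ = 0#
  ⟦ true  ⟧₂ = 1#

  F₂ : RawRing 0ℓ 0ℓ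
  F₂ = CommutativeRing.rawRing xor-∧-commutativeRing

  F₂⟶F : F₂ -Raw-AlmostCommutative⟶ fromCommutativeRing commutativeRing
  F₂⟶F = record
    { ⟦_⟧    = ⟦_⟧₂
    ; +-homo = λ { false y → sym (+-identityˡ _) ; true false → sym (+-identityʳ 1#) ; true true → sym 1+1≡0 }
    ; *-homo = λ { false y → sym (zeroˡ _) ; true y → sym (*-identityˡ _) }
    ; -‿homo = λ { false → sym -0≡0 ; true → sym -1≡1 }
    ; 0-homo = refl
    ; 1-homo = refl
    }

  ⟦⟧₂-≟ : WeaklyDecidable (Induced-equivalence F₂⟶F)
  ⟦⟧₂-≟ false false = just refl
  ⟦⟧₂-≟ true  true  = just refl
  ⟦⟧₂-≟ _     _     = nothing

  -- A ring solver with coefficients in F₂: normal forms are computed modulo 2,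
  -- so it proves exactly the polynomial identities of characteristic two.
  open import Algebra.Solver.Ring F₂ (fromCommutativeRing commutativeRing) F₂⟶F ⟦⟧₂-≟ public
    using (solve; _:=_; _:+_; _:*_; con)

  x+x≡0 : ∀ x → x + x ≡ 0#
  x+x≡0 = solve 1 (λ x → x :+ x := con false) refl

  +≡0⇒≡ : ∀ {x y} → x + y ≡ 0# → x ≡ y
  +≡0⇒≡ {x} {y} eq = begin
    x           ≡⟨ solve 2 (λ x y → x := (x :+ y) :+ y) refl x y ⟩
    (x + y) + y ≡⟨ cong (_+ y) eq ⟩
    0# + y      ≡⟨ +-identityˡ y ⟩
    y           ∎

  +≡+-swap : ∀ {a b c d} → a + b ≡ c + d → a + c ≡ b + d
  +≡+-swap {a} {b} {c} {d} eq = +≡0⇒≡ (begin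
    (a + c) + (b + d) ≡⟨ solve 4 (λ a b c d → (a :+ c) :+ (b :+ d) := (a :+ b) :+ (c :+ d)) refl a b c d ⟩
    (a + b) + (c + d) ≡⟨ cong (_+ (c + d)) eq ⟩
    (c + d) + (c + d) ≡⟨ x+x≡0 (c + d) ⟩
    0#                ∎)

  ^2^k-+ : ∀ k x y → (x + y) ^ (2 ^ℕ k) ≡ x ^ (2 ^ℕ k) + y ^ (2 ^ℕ k)
  ^2^k-+ zero    x y = solve 2 (λ x y → (x :+ y) :* con true := x :* con true :+ y :* con true) refl x y
  ^2^k-+ (suc k) x y = begin
    (x + y) ^ (2 *ℕ K)                ≡⟨ ^-double (x + y) K ⟩
    (x + y) ^ K * (x + y) ^ K         ≡⟨ cong (λ z → z * z) (^2^k-+ k x y) ⟩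
    (x ^ K + y ^ K) * (x ^ K + y ^ K) ≡⟨ solve 2 (λ X Y → (X :+ Y) :* (X :+ Y) := X :* X :+ Y :* Y) refl (x ^ K) (y ^ K) ⟩
    x ^ K * x ^ K + y ^ K * y ^ K     ≡⟨ cong₂ _+_ (^-double x K) (^-double y K) ⟨
    x ^ (2 *ℕ K) + y ^ (2 *ℕ K)       ∎
    where K : ℕ
          K = 2 ^ℕ k

  0^2^k≡0 : ∀ k → 0# ^ (2 ^ℕ k) ≡ 0#
  0^2^k≡0 k = trans (cong (_^ (2 ^ℕ k)) (sym (x+x≡0 0#))) (trans (^2^k-+ k 0# 0#) (x+x≡0 _))

module FiniteField {n} (F : FieldOfOrder n) where
  open FieldNotation F
  open FieldProperties field'
  open Inverse enumeration using (to; from; strictlyInverseˡ; strictlyInverseʳ)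
  open import Algebra.Properties.CommutativeMonoid.Sum (CommutativeRing.*-commutativeMonoid commutativeRing)
    using (sum-permute; sum-remove; sum-cong-≗; ∑-distrib-+; sum-replicate) renaming (sum to ∏)
  open ≡-Reasoning

  infix 4 _≟_
  _≟_ : DecidableEquality Carrier
  x ≟ y = Dec.map′ (Injection.injective (↔⇒↣ enumeration)) (cong to) (to x Finₚ.≟ to y)

  IsPermutation⇔Injective : ∀ f → IsPermutation f ⇔ Injective _≡_ _≡_ f
  IsPermutation⇔Injective f = mk⇔ proj₁ (finite-injective⇒bijective enumeration f)

  ∏-≢0 : ∀ {k} (f : Fin k → Carrier) → (∀ i → f i ≢ 0#) → ∏ f ≢ 0#
  ∏-≢0 {zero}  f f≢0 = 0≢1 ∘ sym
  ∏-≢0 {suc k} f f≢0 = *-≢0 (f≢0 Fin.zero) (∏-≢0 (f ∘ Fin.suc) (f≢0 ∘ Fin.suc))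

  ∏-scale : ∀ {k} x (f : Fin k → Carrier) → ∏ (λ i → x * f i) ≡ x ^ k * ∏ f
  ∏-scale {k} x f = trans (∑-distrib-+ (λ _ → x) f) (cong (_* ∏ f) (trans (sum-replicate k) (sym (^≡Exp^ x k))))

  ∏-differ-at : ∀ {k} (f g : Fin k → Carrier) i {x} →
                f i ≡ x * g i → (∀ j → j ≢ i → f j ≡ g j) → ∏ f ≡ x * ∏ g
  ∏-differ-at {suc k} f g i {x} fi≡x*gi f≡g = begin
    ∏ f                          ≡⟨ sum-remove f ⟩
    f i * ∏ (removeAt f i)       ≡⟨ cong₂ _*_ fi≡x*gi (sum-cong-≗ (λ j → f≡g _ (Finₚ.punchInᵢ≢i i j))) ⟩
    (x * g i) * ∏ (removeAt g i) ≡⟨ *-assoc x (g i) _ ⟩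
    x * (g i * ∏ (removeAt g i)) ≡⟨ cong (x *_) (sum-remove g) ⟨
    x * ∏ g                      ∎

  unitPart : Carrier → Carrier
  unitPart y with y ≟ 0#
  ... | yes _ = 1#
  ... | no  _ = y

  unitPart-≢0 : ∀ y → unitPart y ≢ 0#
  unitPart-≢0 y with y ≟ 0#
  ... | yes _  = 0≢1 ∘ sym
  ... | no y≢0 = y≢0

  ≢0⇒unitPart≡ : ∀ {y} → y ≢ 0# → unitPart y ≡ y
  ≢0⇒unitPart≡ {y} y≢0 with y ≟ 0#
  ... | yes y≡0 = contradiction y≡0 y≢0
  ... | no  _   = refl

  ∏-unitPart-*-invariant : ∀ {x} → x ≢ 0# → ∏ (λ i → unitPart (x * from i)) ≡ ∏ (unitPart ∘ from)
  ∏-unitPart-*-invariant x≢0 = sym (trans (sum-permute (unitPart ∘ from) π)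
      (sum-cong-≗ {n} (λ i → cong unitPart (strictlyInverseʳ _))))
    where π : Permutation n n
          π = enumeration ↔-∘ (*-↔ x≢0 ↔-∘ ↔-sym enumeration)

  -- P, the product of unitPart over the field, is fixed by x * _, while ∏ (x * unitPart y)
  -- equals x ^ n * P and differs from ∏ unitPart (x * y) only in the factor at y = 0.
  ^-order-≢0 : ∀ {x} → x ≢ 0# → x ^ n ≡ x
  ^-order-≢0 {x} x≢0 = *-cancelˡ (∏-≢0 (unitPart ∘ from) (unitPart-≢0 ∘ from)) (begin
    P * x ^ n                           ≡⟨ *-comm P (x ^ n) ⟩
    x ^ n * P                           ≡⟨ ∏-scale x (unitPart ∘ from) ⟨
    ∏ (λ i → x * unitPart (from i))     ≡⟨ ∏-differ-at _ _ (to 0#) at-zero elsewhere ⟩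
    x * ∏ (λ i → unitPart (x * from i)) ≡⟨ cong (x *_) (∏-unitPart-*-invariant x≢0) ⟩
    x * P                               ≡⟨ *-comm x P ⟩
    P * x                               ∎)
    where
    P : Carrier
    P = ∏ (unitPart ∘ from)
    at-zero : x * unitPart (from (to 0#)) ≡ x * unitPart (x * from (to 0#))
    at-zero = cong (λ y → x * unitPart y) (begin
      from (to 0#)     ≡⟨ strictlyInverseʳ 0# ⟩
      0#               ≡⟨ zeroʳ x ⟨
      x * 0#           ≡⟨ cong (x *_) (strictlyInverseʳ 0#) ⟨
      x * from (to 0#) ∎)
    elsewhere : ∀ j → j ≢ to 0# → x * unitPart (from j) ≡ unitPart (x * from j)
    elsewhere j j≢0 = trans (cong (x *_) (≢0⇒unitPart≡ from-j≢0)) (sym (≢0⇒unitPart≡ (*-≢0 x≢0 from-j≢0)))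
      where from-j≢0 : from j ≢ 0#
            from-j≢0 eq = j≢0 (trans (sym (strictlyInverseˡ j)) (cong to eq))

  0^n≡0 : 0# ^ n ≡ 0#
  0^n≡0 = 0^≡0 (to 0#)
    where
    0^≡0 : ∀ {k} → Fin k → 0# ^ k ≡ 0#
    0^≡0 {suc k} _ = zeroˡ _

  ^-order : ∀ x → x ^ n ≡ x
  ^-order x with x ≟ 0#
  ... | yes refl = 0^n≡0
  ... | no  x≢0  = ^-order-≢0 x≢0

  ^-involutive : ∀ k → n ≡ k *ℕ k → ∀ x → (x ^ k) ^ k ≡ x
  ^-involutive k n≡k² x = trans (^-assocʳ x k k) (trans (cong (x ^_) (sym n≡k²)) (^-order x))

  evenOrder⇒1+1≡0 : ∀ j → n ≡ 2 *ℕ j → 1# + 1# ≡ 0#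
  evenOrder⇒1+1≡0 j n≡2j = trans (cong (1# +_) (sym -1≡1)) (-‿inverseʳ 1#)
    where
    -1≡1 : - 1# ≡ 1#
    -1≡1 = begin
      - 1#              ≡⟨ ^-order (- 1#) ⟨
      (- 1#) ^ n        ≡⟨ cong ((- 1#) ^_) n≡2j ⟩
      (- 1#) ^ (2 *ℕ j) ≡⟨ ^-assocʳ (- 1#) 2 j ⟨
      ((- 1#) ^ 2) ^ j  ≡⟨ cong (_^ j) -1^2≡1 ⟩
      1# ^ j            ≡⟨ 1^n≡1 j ⟩
      1#                ∎

module CharacteristicTwoFiniteField {n} (F : FieldOfOrder n)
    (1+1≡0 : FieldOfOrder._+_ F (FieldOfOrder.1# F) (FieldOfOrder.1# F) ≡ FieldOfOrder.0# F) where
  open FieldNotation F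
  open FieldProperties field'
  open CharacteristicTwo field' 1+1≡0
  open FiniteField F
  open ≡-Reasoning

  square-injective : ∀ {x y} → x * x ≡ y * y → x ≡ y
  square-injective {x} {y} x²≡y² = +≡0⇒≡ (decidable-stable (x + y ≟ 0#) λ x+y≢0 → *-≢0 x+y≢0 x+y≢0 (begin
    (x + y) * (x + y) ≡⟨ solve 2 (λ x y → (x :+ y) :* (x :+ y) := x :* x :+ y :* y) refl x y ⟩
    x * x + y * y     ≡⟨ cong (_+ y * y) x²≡y² ⟩
    y * y + y * y     ≡⟨ x+x≡0 (y * y) ⟩
    0#                ∎))

  traceTo2-square : ∀ k u → traceTo2 k u * traceTo2 k u + u ≡ traceTo2 (suc k) u
  traceTo2-square zero    u = solve 1 (λ u → con false :* con false :+ u := con false :+ u :* con true) refl u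
  traceTo2-square (suc k) u = begin
    (t + U) * (t + U) + u    ≡⟨ solve 3 (λ t U u → (t :+ U) :* (t :+ U) :+ u := (t :* t :+ u) :+ U :* U) refl t U u ⟩
    (t * t + u) + U * U      ≡⟨ cong₂ _+_ (traceTo2-square k u) (sym (^-double u (2 ^ℕ k))) ⟩
    traceTo2 (suc (suc k)) u ∎
    where t U : Carrier
          t = traceTo2 k u
          U = u ^ (2 ^ℕ k)

  root-^2^k : ∀ {α u} → α * α + α ≡ u → ∀ k → α ^ (2 ^ℕ k) ≡ α + traceTo2 k u
  root-^2^k {α} {u} α²+α≡u zero    = solve 1 (λ α → α :* con true := α :+ con false) refl α
  root-^2^k {α} {u} α²+α≡u (suc k) = begin
    α ^ (2 *ℕ 2 ^ℕ k)           ≡⟨ ^-double α (2 ^ℕ k) ⟩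
    α ^ (2 ^ℕ k) * α ^ (2 ^ℕ k) ≡⟨ cong (λ z → z * z) (root-^2^k α²+α≡u k) ⟩
    (α + t) * (α + t)           ≡⟨ solve 2 (λ α t → (α :+ t) :* (α :+ t) := α :+ (t :* t :+ (α :* α :+ α))) refl α t ⟩
    α + (t * t + (α * α + α))   ≡⟨ cong (λ z → α + (t * t + z)) α²+α≡u ⟩
    α + (t * t + u)             ≡⟨ cong (α +_) (traceTo2-square k u) ⟩
    α + traceTo2 (suc k) u      ∎
    where t : Carrier
          t = traceTo2 k u

  traceTo2-telescope : ∀ k z → traceTo2 k (z * z + z) ≡ z ^ (2 ^ℕ k) + z
  traceTo2-telescope zero    z = solve 1 (λ z → con false := z :* con true :+ z) refl z
  traceTo2-telescope (suc k) z = begin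
    traceTo2 k (z * z + z) + (z * z + z) ^ K ≡⟨ cong₂ _+_ (traceTo2-telescope k z) (^2^k-+ k (z * z) z) ⟩
    (Z + z) + ((z * z) ^ K + Z)              ≡⟨ cong (λ w → (Z + z) + (w + Z)) (^-distrib-* z z K) ⟩
    (Z + z) + (Z * Z + Z)                    ≡⟨ solve 2 (λ Z z → (Z :+ z) :+ (Z :* Z :+ Z) := Z :* Z :+ z) refl Z z ⟩
    Z * Z + z                                ≡⟨ cong (_+ z) (^-double z K) ⟨
    z ^ (2 *ℕ K) + z                         ∎
    where K : ℕ
          K = 2 ^ℕ k
          Z : Carrier
          Z = z ^ K

  traceTo2-1#-odd : ∀ k → k % 2 ≡ 1 → traceTo2 k 1# ≡ 1#
  traceTo2-1#-odd (suc zero)    _   = solve 0 (con false :+ con true :* con true := con true) refl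
  traceTo2-1#-odd (suc (suc k)) odd = begin
    traceTo2 k 1# + 1# ^ (2 ^ℕ k) + 1# ^ (2 ^ℕ suc k)
      ≡⟨ cong₂ (λ x y → traceTo2 k 1# + x + y) (1^n≡1 (2 ^ℕ k)) (1^n≡1 (2 ^ℕ suc k)) ⟩
    traceTo2 k 1# + 1# + 1#                           ≡⟨ solve 1 (λ t → t :+ con true :+ con true := t) refl (traceTo2 k 1#) ⟩
    traceTo2 k 1#                                     ≡⟨ traceTo2-1#-odd k odd ⟩
    1#                                                ∎

  -- For even k, oddTrace u k solves w² + w = traceTo2 k u + u + u ^ (2 ^ k); for u ∈ 𝔽_(2^k)
  -- of trace 1 it is therefore a primitive cube root of unity.
  oddTrace : Carrier → ℕ → Carrier
  oddTrace u zero          = 0#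
  oddTrace u (suc zero)    = 0#
  oddTrace u (suc (suc k)) = oddTrace u k + u ^ (2 ^ℕ suc k)

  oddTrace-root : ∀ u k → k % 2 ≡ 0 →
                  oddTrace u k * oddTrace u k + oddTrace u k ≡ traceTo2 k u + u + u ^ (2 ^ℕ k)
  oddTrace-root u zero          _    = solve 1 (λ u → con false :* con false :+ con false := con false :+ u :+ u :* con true) refl u
  oddTrace-root u (suc (suc k)) even = begin
    (w + V) * (w + V) + (w + V) ≡⟨ solve 2 (λ w V → (w :+ V) :* (w :+ V) :+ (w :+ V) := (w :* w :+ w) :+ V :+ V :* V) refl w V ⟩
    (w * w + w) + V + V * V     ≡⟨ cong₂ (λ x y → x + V + y) (oddTrace-root u k even) (sym (^-double u (2 ^ℕ suc k))) ⟩
    (traceTo2 k u + u + U) + V + u ^ (2 ^ℕ suc (suc k))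
      ≡⟨ solve 5 (λ t u U V W → (t :+ u :+ U) :+ V :+ W := (t :+ U :+ V) :+ u :+ W) refl (traceTo2 k u) u U V _ ⟩
    traceTo2 (suc (suc k)) u + u + u ^ (2 ^ℕ suc (suc k)) ∎
    where w U V : Carrier
          w = oddTrace u k
          U = u ^ (2 ^ℕ k)
          V = u ^ (2 ^ℕ suc k)

  module Subfield (m′ : ℕ) where
    m q : ℕ
    m = suc m′
    q = 2 ^ℕ m

    𝔽q : Carrier → Set
    𝔽q = InSubfield q

    ^q-+ : ∀ x y → (x + y) ^ q ≡ x ^ q + y ^ q
    ^q-+ = ^2^k-+ m

    𝔽q-0 : 𝔽q 0#
    𝔽q-0 = 0^2^k≡0 m

    𝔽q-1 : 𝔽q 1#
    𝔽q-1 = 1^n≡1 q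

    𝔽q-+ : ∀ {x y} → 𝔽q x → 𝔽q y → 𝔽q (x + y)
    𝔽q-+ {x} {y} x∈ y∈ = trans (^q-+ x y) (cong₂ _+_ x∈ y∈)

    𝔽q-* : ∀ {x y} → 𝔽q x → 𝔽q y → 𝔽q (x * y)
    𝔽q-* {x} {y} x∈ y∈ = trans (^-distrib-* x y q) (cong₂ _*_ x∈ y∈)

    𝔽q-^ : ∀ {x} k → 𝔽q x → 𝔽q (x ^ k)
    𝔽q-^ {x} k x∈ = begin
      (x ^ k) ^ q  ≡⟨ ^-assocʳ x k q ⟩
      x ^ (k *ℕ q) ≡⟨ cong (x ^_) (ℕ.*-comm k q) ⟩
      x ^ (q *ℕ k) ≡⟨ ^-assocʳ x q k ⟨
      (x ^ q) ^ k  ≡⟨ cong (_^ k) x∈ ⟩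
      x ^ k        ∎

    𝔽q-inv : ∀ {x} → 𝔽q x → (x≢0 : x ≢ 0#) → 𝔽q (inv x x≢0)
    𝔽q-inv {x} x∈ x≢0 = *-cancelˡ x≢0 (begin
      x * x⁻¹ ^ q     ≡⟨ cong (_* x⁻¹ ^ q) x∈ ⟨
      x ^ q * x⁻¹ ^ q ≡⟨ ^-distrib-* x x⁻¹ q ⟨
      (x * x⁻¹) ^ q   ≡⟨ cong (_^ q) (*-inv x≢0) ⟩
      1# ^ q          ≡⟨ 𝔽q-1 ⟩
      1#              ≡⟨ *-inv x≢0 ⟨
      x * x⁻¹         ∎)
      where x⁻¹ : Carrier
            x⁻¹ = inv x x≢0

    𝔽q-oddTrace : ∀ {u} → 𝔽q u → ∀ k → 𝔽q (oddTrace u k)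
    𝔽q-oddTrace u∈ zero          = 𝔽q-0
    𝔽q-oddTrace u∈ (suc zero)    = 𝔽q-0
    𝔽q-oddTrace u∈ (suc (suc k)) = 𝔽q-+ (𝔽q-oddTrace u∈ k) (𝔽q-^ (2 ^ℕ suc k) u∈)

    InjectiveOn-∘affine : ∀ (g : Carrier → Carrier) {k e} → k ≢ 0# → 𝔽q k → 𝔽q e →
                          InjectiveOn 𝔽q (λ y → g (k * y + e)) ⇔ InjectiveOn 𝔽q g
    InjectiveOn-∘affine g {k} {e} k≢0 k∈ e∈ = mk⇔ from-composite to-composite
      where
      φ ψ : Carrier → Carrier
      φ y = k * y + e
      ψ r = inv k k≢0 * (r + e)
      φ∘ψ : ∀ r → φ (ψ r) ≡ r
      φ∘ψ r = trans (cong (_+ e) (inv-cancelʳ k≢0 (r + e))) (solve 2 (λ r e → r :+ e :+ e := r) refl r e)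
      φ-𝔽q : ∀ {y} → 𝔽q y → 𝔽q (φ y)
      φ-𝔽q y∈ = 𝔽q-+ (𝔽q-* k∈ y∈) e∈
      ψ-𝔽q : ∀ {r} → 𝔽q r → 𝔽q (ψ r)
      ψ-𝔽q r∈ = 𝔽q-* (𝔽q-inv k∈ k≢0) (𝔽q-+ r∈ e∈)
      from-composite : InjectiveOn 𝔽q (g ∘ φ) → InjectiveOn 𝔽q g
      from-composite inj {r} {r′} r∈ r′∈ gr≡gr′ = begin
        r        ≡⟨ φ∘ψ r ⟨
        φ (ψ r)  ≡⟨ cong φ (inj (ψ-𝔽q r∈) (ψ-𝔽q r′∈) (trans (cong g (φ∘ψ r)) (trans gr≡gr′ (sym (cong g (φ∘ψ r′)))))) ⟩
        φ (ψ r′) ≡⟨ φ∘ψ r′ ⟩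
        r′       ∎
      to-composite : InjectiveOn 𝔽q g → InjectiveOn 𝔽q (g ∘ φ)
      to-composite inj y∈ y′∈ eq = *-cancelˡ k≢0 (+-cancelʳ e _ _ (inj (φ-𝔽q y∈) (φ-𝔽q y′∈) eq))

    InjectiveOn-∘+ : ∀ (g : Carrier → Carrier) {e} → 𝔽q e → InjectiveOn 𝔽q (λ y → g (y + e)) ⇔ InjectiveOn 𝔽q g
    InjectiveOn-∘+ g e∈ = ⇔-trans (InjectiveOn-cong⇔ (λ {y} _ → cong (λ z → g (z + _)) (sym (*-identityˡ y))))
                                  (InjectiveOn-∘affine g (0≢1 ∘ sym) 𝔽q-1 e∈)

    quadratic-injective⇔ : ∀ {b c} → 𝔽q b → 𝔽q c → c ≢ 0# →
                           InjectiveOn 𝔽q (λ y → b * y * y + (b * b + c) * y) ⇔ (b ≡ 0# ⊎ b * b ≡ c)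
    quadratic-injective⇔ {b} {c} b∈ c∈ c≢0 = mk⇔ necessary sufficient
      where
      Q : Carrier → Carrier
      Q y = b * y * y + (b * b + c) * y

      sufficient : b ≡ 0# ⊎ b * b ≡ c → InjectiveOn 𝔽q Q
      sufficient (inj₁ refl) = InjectiveOn-cong
        (λ {y} _ → solve 2 (λ c y → c :* y := con false :* y :* y :+ (con false :* con false :+ c) :* y) refl c y)
        (λ _ _ → *-cancelˡ c≢0)
      sufficient (inj₂ refl) = InjectiveOn-cong
        (λ {y} _ → solve 2 (λ b y → b :* (y :* y) := b :* y :* y :+ (b :* b :+ b :* b) :* y) refl b y)
        (λ _ _ → square-injective ∘ *-cancelˡ b≢0)
        where b≢0 : b ≢ 0#
              b≢0 b≡0 = c≢0 (trans (cong (λ z → z * z) b≡0) (zeroˡ 0#))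

      necessary : InjectiveOn 𝔽q Q → b ≡ 0# ⊎ b * b ≡ c
      necessary inj with b ≟ 0# | b * b ≟ c
      ... | yes b≡0 | _        = inj₁ b≡0
      ... | no _    | yes b²≡c = inj₂ b²≡c
      ... | no b≢0  | no b²≢c  = contradiction (inj y₀∈ 𝔽q-0 (trans Qy₀≡0 (sym Q0≡0))) y₀≢0
        where
        s y₀ : Carrier
        s  = b * b + c
        y₀ = inv b b≢0 * s
        y₀∈ : 𝔽q y₀
        y₀∈ = 𝔽q-* (𝔽q-inv b∈ b≢0) (𝔽q-+ (𝔽q-* b∈ b∈) c∈)
        y₀≢0 : y₀ ≢ 0#
        y₀≢0 = *-≢0 (inv-≢0 b≢0) (b²≢c ∘ +≡0⇒≡)
        Qy₀≡0 : Q y₀ ≡ 0#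
        Qy₀≡0 = begin
          Q y₀              ≡⟨ solve 3 (λ b s y → b :* y :* y :+ s :* y := y :* (b :* y :+ s)) refl b s y₀ ⟩
          y₀ * (b * y₀ + s) ≡⟨ cong (λ z → y₀ * (z + s)) (inv-cancelʳ b≢0 s) ⟩
          y₀ * (s + s)      ≡⟨ cong (y₀ *_) (x+x≡0 s) ⟩
          y₀ * 0#           ≡⟨ zeroʳ y₀ ⟩
          0#                ∎
        Q0≡0 : Q 0# ≡ 0#
        Q0≡0 = solve 2 (λ b s → b :* con false :* con false :+ s :* con false := con false) refl b s

    cubic-shift⇔ : ∀ {d e f} → d ≢ 0# → 𝔽q d → 𝔽q e →
                   InjectiveOn 𝔽q (λ y → d * y * y * y + e * y * y + f * y)
                   ⇔ InjectiveOn 𝔽q (λ r → r * r * r + (e * e + d * f) * r)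
    cubic-shift⇔ {d} {e} {f} d≢0 d∈ e∈ =
      ⇔-trans (⇔-sym (⇔-trans (InjectiveOn-+ʳ (λ y → d * d * P y) (d * f * e)) (InjectiveOn-*ˡ P (*-≢0 d≢0 d≢0))))
      (⇔-trans (InjectiveOn-cong⇔ (λ {y} _ → substitution y)) (InjectiveOn-∘affine Q d≢0 d∈ e∈))
      where
      P Q : Carrier → Carrier
      P y = d * y * y * y + e * y * y + f * y
      Q r = r * r * r + (e * e + d * f) * r
      substitution : ∀ y → d * d * P y + d * f * e ≡ Q (d * y + e)
      substitution = solve 4 (λ d e f y →
        d :* d :* (d :* y :* y :* y :+ e :* y :* y :+ f :* y) :+ d :* f :* e
        := (d :* y :+ e) :* (d :* y :+ e) :* (d :* y :+ e) :+ (e :* e :+ d :* f) :* (d :* y :+ e)) refl d e f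

    traceTo2-w²+w≡0 : ∀ {w} → 𝔽q w → traceTo2 m (w * w + w) ≡ 0#
    traceTo2-w²+w≡0 {w} w∈ = trans (traceTo2-telescope m w) (trans (cong (_+ w) w∈) (x+x≡0 w))

    cube-root-of-unity : m % 2 ≡ 1 → ∀ {w} → 𝔽q w → w * w * w ≡ 1# → w ≡ 1#
    cube-root-of-unity odd {w} w∈ w³≡1 = +≡0⇒≡ (decidable-stable (w + 1# ≟ 0#) w+1≢0-absurd)
      where
      factorisation : (w + 1#) * (w * w + w + 1#) ≡ 0#
      factorisation = begin
        (w + 1#) * (w * w + w + 1#) ≡⟨ solve 1 (λ w → (w :+ con true) :* (w :* w :+ w :+ con true) := w :* w :* w :+ con true) refl w ⟩
        w * w * w + 1#              ≡⟨ cong (_+ 1#) w³≡1 ⟩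
        1# + 1#                     ≡⟨ 1+1≡0 ⟩
        0#                          ∎
      w+1≢0-absurd : ¬ (w + 1# ≢ 0#)
      w+1≢0-absurd w+1≢0 = 0≢1 (begin
        0#                     ≡⟨ traceTo2-w²+w≡0 w∈ ⟨
        traceTo2 m (w * w + w) ≡⟨ cong (traceTo2 m) (+≡0⇒≡ (*≡0⇒≡0 w+1≢0 factorisation)) ⟩
        traceTo2 m 1#          ≡⟨ traceTo2-1#-odd m odd ⟩
        1#                     ∎)

    cube-injective : m % 2 ≡ 1 → InjectiveOn 𝔽q (λ r → r * r * r)
    cube-injective odd {r} {r′} r∈ r′∈ r³≡r′³ with r′ ≟ 0#
    ... | yes refl = decidable-stable (r ≟ 0#) (λ r≢0 → *-≢0 (*-≢0 r≢0 r≢0) r≢0 (trans r³≡r′³ (zeroʳ _)))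
    ... | no r′≢0  = begin
      r       ≡⟨ inv-cancelʳ r′≢0 r ⟨
      r′ * w  ≡⟨ cong (r′ *_) (cube-root-of-unity odd (𝔽q-* (𝔽q-inv r′∈ r′≢0) r∈) w³≡1) ⟩
      r′ * 1# ≡⟨ *-identityʳ r′ ⟩
      r′      ∎
      where
      w : Carrier
      w = inv r′ r′≢0 * r
      w³≡1 : w * w * w ≡ 1#
      w³≡1 = *-cancelˡ (*-≢0 (*-≢0 r′≢0 r′≢0) r′≢0) (begin
        r′ * r′ * r′ * (w * w * w)     ≡⟨ solve 2 (λ r w → r :* r :* r :* (w :* w :* w) := (r :* w) :* (r :* w) :* (r :* w)) refl r′ w ⟩
        (r′ * w) * (r′ * w) * (r′ * w) ≡⟨ cong (λ z → z * z * z) (inv-cancelʳ r′≢0 r) ⟩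
        r * r * r                      ≡⟨ r³≡r′³ ⟩
        r′ * r′ * r′                   ≡⟨ *-identityʳ _ ⟨
        r′ * r′ * r′ * 1#              ∎)

    cube-not-injective : ∀ {u} → 𝔽q u → traceTo2 m u ≡ 1# → m % 2 ≡ 0 → ¬ InjectiveOn 𝔽q (λ r → r * r * r)
    cube-not-injective {u} u∈ tr≡1 even inj = w≢1 (inj (𝔽q-oddTrace u∈ m) 𝔽q-1 (trans w³≡1 (sym 1³≡1)))
      where
      w : Carrier
      w = oddTrace u m
      w²+w≡1 : w * w + w ≡ 1#
      w²+w≡1 = begin
        w * w + w                ≡⟨ oddTrace-root u m even ⟩
        traceTo2 m u + u + u ^ q ≡⟨ cong₂ (λ t v → t + u + v) tr≡1 u∈ ⟩
        1# + u + u               ≡⟨ solve 1 (λ u → con true :+ u :+ u := con true) refl u ⟩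
        1#                       ∎
      w³≡1 : w * w * w ≡ 1#
      w³≡1 = begin
        w * w * w                         ≡⟨ solve 1 (λ w → w :* w :* w := (w :* w :+ w) :* w :+ (w :* w :+ w) :+ w) refl w ⟩
        (w * w + w) * w + (w * w + w) + w ≡⟨ cong (λ t → t * w + t + w) w²+w≡1 ⟩
        1# * w + 1# + w                   ≡⟨ solve 1 (λ w → con true :* w :+ con true :+ w := con true) refl w ⟩
        1#                                ∎
      1³≡1 : 1# * 1# * 1# ≡ 1#
      1³≡1 = solve 0 (con true :* con true :* con true := con true) refl
      w≢1 : w ≢ 1#
      w≢1 w≡1 = 0≢1 (begin
        0#           ≡⟨ solve 0 (con false := con true :* con true :+ con true) refl ⟩
        1# * 1# + 1# ≡⟨ cong (λ z → z * z + z) w≡1 ⟨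
        w * w + w    ≡⟨ w²+w≡1 ⟩
        1#           ∎)

    cubic-injective⇔ : ∀ {u K} → 𝔽q u → traceTo2 m u ≡ 1# → 𝔽q K →
                       InjectiveOn 𝔽q (λ r → r * r * r + K * r) ⇔ (K ≡ 0# × m % 2 ≡ 1)
    cubic-injective⇔ {u} {K} u∈ tr≡1 K∈ = mk⇔ necessary sufficient
      where
      C : Carrier → Carrier
      C r = r * r * r + K * r

      K≡0⇒C≡cube : K ≡ 0# → ∀ {r} → 𝔽q r → C r ≡ r * r * r
      K≡0⇒C≡cube refl {r} _ = solve 1 (λ r → r :* r :* r :+ con false :* r := r :* r :* r) refl r

      sufficient : K ≡ 0# × m % 2 ≡ 1 → InjectiveOn 𝔽q C
      sufficient (K≡0 , odd) = InjectiveOn-cong (sym ∘ K≡0⇒C≡cube K≡0) (cube-injective odd)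

      K≡0 : InjectiveOn 𝔽q C → K ≡ 0#
      K≡0 inj = decidable-stable (K ≟ 0#) λ K≢0 →
        ^-≢0 (2 ^ℕ m′) K≢0 (inj (𝔽q-^ (2 ^ℕ m′) K∈) 𝔽q-0 (trans C√K≡0 (sym C0≡0)))
        where
        √K : Carrier
        √K = K ^ (2 ^ℕ m′)
        C√K≡0 : C √K ≡ 0#
        C√K≡0 = begin
          √K * √K * √K + K * √K ≡⟨ cong (λ z → z * √K + K * √K) (trans (sym (^-double K (2 ^ℕ m′))) K∈) ⟩
          K * √K + K * √K       ≡⟨ x+x≡0 (K * √K) ⟩
          0#                    ∎
        C0≡0 : C 0# ≡ 0#
        C0≡0 = solve 1 (λ K → con false :* con false :* con false :+ K :* con false := con false) refl K

      necessary : InjectiveOn 𝔽q C → K ≡ 0# × m % 2 ≡ 1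
      necessary inj with m%2≡0⊎m%2≡1 m
      ... | inj₁ even = ⊥-elim (cube-not-injective u∈ tr≡1 even (InjectiveOn-cong (K≡0⇒C≡cube (K≡0 inj)) inj))
      ... | inj₂ odd  = K≡0 inj , odd

    module QuadraticExtension (^q-involutive : ∀ x → (x ^ q) ^ q ≡ x) where

      Tr Nm : Carrier → Carrier
      Tr x = x ^ q + x
      Nm x = x * x ^ q

      Tr-𝔽q : ∀ x → 𝔽q (Tr x)
      Tr-𝔽q x = trans (^q-+ (x ^ q) x) (trans (cong (_+ x ^ q) (^q-involutive x)) (+-comm x (x ^ q)))

      Nm-𝔽q : ∀ x → 𝔽q (Nm x)
      Nm-𝔽q x = trans (^-distrib-* x (x ^ q) q) (trans (cong (x ^ q *_) (^q-involutive x)) (*-comm (x ^ q) x))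

      Nm-≢0 : ∀ {x} → x ≢ 0# → Nm x ≢ 0#
      Nm-≢0 x≢0 = *-≢0 x≢0 (^-≢0 q x≢0)

      Tr-+ : ∀ x y → Tr (x + y) ≡ Tr x + Tr y
      Tr-+ x y = trans (cong (_+ (x + y)) (^q-+ x y))
        (solve 4 (λ X Y x y → X :+ Y :+ (x :+ y) := X :+ x :+ (Y :+ y)) refl (x ^ q) (y ^ q) x y)

      Tr-*ˡ : ∀ {k} x → 𝔽q k → Tr (k * x) ≡ k * Tr x
      Tr-*ˡ {k} x k∈ = trans (cong (_+ k * x) (trans (^-distrib-* k x q) (cong (_* x ^ q) k∈)))
        (solve 3 (λ k X x → k :* X :+ k :* x := k :* (X :+ x)) refl k (x ^ q) x)

      𝔽q⇒Tr≡0 : ∀ {x} → 𝔽q x → Tr x ≡ 0#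
      𝔽q⇒Tr≡0 {x} x∈ = trans (cong (_+ x) x∈) (x+x≡0 x)

      Tr-conj-* : ∀ γ z → Tr (γ ^ q * (γ * z)) ≡ Nm γ * Tr z
      Tr-conj-* γ z = trans (cong Tr (solve 3 (λ g G z → G :* (g :* z) := (g :* G) :* z) refl γ (γ ^ q) z))
                            (Tr-*ˡ z (Nm-𝔽q γ))

      Tr-conj-twisted : ∀ γ y → Tr (γ ^ q * (y ^ q * y ^ q * y)) ≡ Nm y * Tr (γ * y)
      Tr-conj-twisted γ y = begin
        (γ̄ * (ȳ * ȳ * y)) ^ q + γ̄ * (ȳ * ȳ * y) ≡⟨ cong (_+ γ̄ * (ȳ * ȳ * y)) conjugate ⟩
        γ * (y * y * ȳ) + γ̄ * (ȳ * ȳ * y)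
          ≡⟨ solve 4 (λ g G y Y → g :* (y :* y :* Y) :+ G :* (Y :* Y :* y) := (y :* Y) :* (G :* Y :+ g :* y)) refl γ γ̄ y ȳ ⟩
        (y * ȳ) * (γ̄ * ȳ + γ * y)               ≡⟨ cong (λ t → (y * ȳ) * (t + γ * y)) (^-distrib-* γ y q) ⟨
        Nm y * Tr (γ * y)                       ∎
        where
        γ̄ ȳ : Carrier
        γ̄ = γ ^ q
        ȳ = y ^ q
        conjugate : (γ̄ * (ȳ * ȳ * y)) ^ q ≡ γ * (y * y * ȳ)
        conjugate = begin
          (γ̄ * (ȳ * ȳ * y)) ^ q   ≡⟨ ^-distrib-* γ̄ (ȳ * ȳ * y) q ⟩
          γ̄ ^ q * (ȳ * ȳ * y) ^ q ≡⟨ cong₂ _*_ (^q-involutive γ) (^-distrib-* (ȳ * ȳ) y q) ⟩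
          γ * ((ȳ * ȳ) ^ q * ȳ)   ≡⟨ cong (λ t → γ * (t * ȳ)) (^-distrib-* ȳ ȳ q) ⟩
          γ * (ȳ ^ q * ȳ ^ q * ȳ) ≡⟨ cong (λ t → γ * (t * t * ȳ)) (^q-involutive y) ⟩
          γ * (y * y * ȳ)         ∎

      module Basis {α u : Carrier} (α²+α≡u : α * α + α ≡ u) (α^q≡α+1 : α ^ q ≡ α + 1#) where

        u∈ : 𝔽q u
        u∈ = begin
          u ^ q                          ≡⟨ cong (_^ q) α²+α≡u ⟨
          (α * α + α) ^ q                ≡⟨ ^q-+ (α * α) α ⟩
          (α * α) ^ q + α ^ q            ≡⟨ cong (_+ α ^ q) (^-distrib-* α α q) ⟩
          α ^ q * α ^ q + α ^ q          ≡⟨ cong (λ t → t * t + t) α^q≡α+1 ⟩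
          (α + 1#) * (α + 1#) + (α + 1#)
            ≡⟨ solve 1 (λ α → (α :+ con true) :* (α :+ con true) :+ (α :+ con true) := α :* α :+ α) refl α ⟩
          α * α + α                      ≡⟨ α²+α≡u ⟩
          u                              ∎

        Tr-*α : ∀ {x} → 𝔽q x → Tr (x * α) ≡ x
        Tr-*α {x} x∈ = trans (cong (_+ x * α) (trans (^-distrib-* x α q) (cong₂ _*_ x∈ α^q≡α+1)))
          (solve 2 (λ x α → x :* (α :+ con true) :+ x :* α := x) refl x α)

        Tr-coords : ∀ {x y} → 𝔽q x → 𝔽q y → Tr (x + y * α) ≡ y
        Tr-coords {x} {y} x∈ y∈ = trans (Tr-+ x (y * α)) (trans (cong₂ _+_ (𝔽q⇒Tr≡0 x∈) (Tr-*α y∈)) (+-identityˡ y))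

        Nm-coords : ∀ {x y} → 𝔽q x → 𝔽q y → Nm (x + y * α) ≡ x * x + x * y + y * y * u
        Nm-coords {x} {y} x∈ y∈ = begin
          (x + y * α) * (x + y * α) ^ q       ≡⟨ cong ((x + y * α) *_) conjugate ⟩
          (x + y * α) * (x + y * (α + 1#))
            ≡⟨ solve 3 (λ x y α → (x :+ y :* α) :* (x :+ y :* (α :+ con true))
                                  := x :* x :+ x :* y :+ y :* y :* (α :* α :+ α)) refl x y α ⟩
          x * x + x * y + y * y * (α * α + α) ≡⟨ cong (λ t → x * x + x * y + y * y * t) α²+α≡u ⟩
          x * x + x * y + y * y * u           ∎
          where
          conjugate : (x + y * α) ^ q ≡ x + y * (α + 1#)
          conjugate = trans (^q-+ x (y * α)) (cong₂ _+_ x∈ (trans (^-distrib-* y α q) (cong₂ _*_ y∈ α^q≡α+1)))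

        *-coords : ∀ c d y b → (c + d * α) * (y + b * α) ≡ (c * y + d * b * u) + (c * b + d * y + d * b) * α
        *-coords c d y b = begin
          (c + d * α) * (y + b * α)
            ≡⟨ solve 5 (λ c d y b α → (c :+ d :* α) :* (y :+ b :* α)
                                      := (c :* y :+ d :* b :* (α :* α :+ α)) :+ (c :* b :+ d :* y :+ d :* b) :* α) refl c d y b α ⟩
          (c * y + d * b * (α * α + α)) + (c * b + d * y + d * b) * α
            ≡⟨ cong (λ t → (c * y + d * b * t) + (c * b + d * y + d * b) * α) α²+α≡u ⟩
          (c * y + d * b * u) + (c * b + d * y + d * b) * α ∎

        module Reduction (H : Carrier → Carrier) {γ : Carrier} (γ≢0 : γ ≢ 0#) where

          f G : Carrier → Carrier
          f x = H (Tr x) + γ * x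
          G s = Nm γ * s + Tr (γ ^ q * H s)

          G≡G⇔ : ∀ s s′ → G s ≡ G s′ ⇔ Nm γ * (s + s′) ≡ Tr (γ ^ q * (H s + H s′))
          G≡G⇔ s s′ = mk⇔
            (λ Gs≡Gs′ → trans (distribˡ (Nm γ) s s′) (trans (+≡+-swap Gs≡Gs′) (sym Tr-γ̄[Hs+Hs′])))
            (λ eq → +≡+-swap (trans (sym (distribˡ (Nm γ) s s′)) (trans eq Tr-γ̄[Hs+Hs′])))
            where
            Tr-γ̄[Hs+Hs′] : Tr (γ ^ q * (H s + H s′)) ≡ Tr (γ ^ q * H s) + Tr (γ ^ q * H s′)
            Tr-γ̄[Hs+Hs′] = trans (cong Tr (distribˡ (γ ^ q) (H s) (H s′))) (Tr-+ _ _)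

          Injective⇒InjectiveOn-𝔽q : Injective _≡_ _≡_ f → InjectiveOn 𝔽q G
          Injective⇒InjectiveOn-𝔽q f-inj {s} {s′} s∈ s′∈ Gs≡Gs′ = begin
            s     ≡⟨ Tr-*α s∈ ⟨
            Tr x  ≡⟨ cong Tr (f-inj fx≡fx′) ⟩
            Tr x′ ≡⟨ Tr-x′ ⟩
            s′    ∎
            where
            z x x′ : Carrier
            z  = inv γ γ≢0 * (H s + H s′)
            x  = s * α
            x′ = x + z
            γz : γ * z ≡ H s + H s′
            γz = inv-cancelʳ γ≢0 (H s + H s′)
            Tr-z : Tr z ≡ s + s′
            Tr-z = *-cancelˡ (Nm-≢0 γ≢0) (begin
              Nm γ * Tr z               ≡⟨ Tr-conj-* γ z ⟨
              Tr (γ ^ q * (γ * z))      ≡⟨ cong (λ t → Tr (γ ^ q * t)) γz ⟩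
              Tr (γ ^ q * (H s + H s′)) ≡⟨ Equivalence.to (G≡G⇔ s s′) Gs≡Gs′ ⟨
              Nm γ * (s + s′)           ∎)
            Tr-x′ : Tr x′ ≡ s′
            Tr-x′ = begin
              Tr (x + z)   ≡⟨ Tr-+ x z ⟩
              Tr x + Tr z  ≡⟨ cong₂ _+_ (Tr-*α s∈) Tr-z ⟩
              s + (s + s′) ≡⟨ solve 2 (λ s s′ → s :+ (s :+ s′) := s′) refl s s′ ⟩
              s′           ∎
            fx≡fx′ : f x ≡ f x′
            fx≡fx′ = begin
              H (Tr x) + γ * x              ≡⟨ cong (λ t → H t + γ * x) (Tr-*α s∈) ⟩
              H s + γ * x                   ≡⟨ solve 3 (λ A A′ X → A :+ X := A′ :+ (X :+ (A :+ A′))) refl (H s) (H s′) (γ * x) ⟩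
              H s′ + (γ * x + (H s + H s′)) ≡⟨ cong₂ (λ t w → H t + (γ * x + w)) (sym Tr-x′) (sym γz) ⟩
              H (Tr x′) + (γ * x + γ * z)   ≡⟨ cong (H (Tr x′) +_) (distribˡ γ x z) ⟨
              H (Tr x′) + γ * x′            ∎

          InjectiveOn-𝔽q⇒Injective : InjectiveOn 𝔽q G → Injective _≡_ _≡_ f
          InjectiveOn-𝔽q⇒Injective G-inj {x} {x′} fx≡fx′ =
            *-cancelˡ γ≢0 (+-cancelˡ (H (Tr x)) (γ * x) (γ * x′) (trans fx≡fx′ (cong (λ t → H t + γ * x′) (sym Trx≡Trx′))))
            where
            Trx≡Trx′ : Tr x ≡ Tr x′
            Trx≡Trx′ = G-inj (Tr-𝔽q x) (Tr-𝔽q x′) (Equivalence.from (G≡G⇔ (Tr x) (Tr x′)) (begin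
              Nm γ * (Tr x + Tr x′)               ≡⟨ cong (Nm γ *_) (Tr-+ x x′) ⟨
              Nm γ * Tr (x + x′)                  ≡⟨ Tr-conj-* γ (x + x′) ⟨
              Tr (γ ^ q * (γ * (x + x′)))         ≡⟨ cong (λ t → Tr (γ ^ q * t)) (distribˡ γ x x′) ⟩
              Tr (γ ^ q * (γ * x + γ * x′))       ≡⟨ cong (λ t → Tr (γ ^ q * t)) (+≡+-swap fx≡fx′) ⟨
              Tr (γ ^ q * (H (Tr x) + H (Tr x′))) ∎))

          Injective⇔InjectiveOn-𝔽q : Injective _≡_ _≡_ f ⇔ InjectiveOn 𝔽q G
          Injective⇔InjectiveOn-𝔽q = mk⇔ Injective⇒InjectiveOn-𝔽q InjectiveOn-𝔽q⇒Injective

        cubic : (b c d : Carrier) → Carrier → Carrier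
        cubic b c d y = d * y * y * y + b * c * y * y + (b * b * (c + d + d * u) + (c * c + c * d + d * d * u)) * y

        G≡cubic : ∀ {a b c d s} → 𝔽q a → 𝔽q b → 𝔽q c → 𝔽q d → 𝔽q s →
                  Nm (c + d * α) * s + Tr ((c + d * α) ^ q * (s + (a + b * α)) ^ (2 *ℕ q +ℕ 1))
                  ≡ cubic b c d (s + a) + ((c * c + c * d + d * d * u) * a + b * b * u * (c * b + d * b))
        G≡cubic {a} {b} {c} {d} {s} a∈ b∈ c∈ d∈ s∈ = begin
          Nm γ * s + Tr (γ ^ q * Y ^ (2 *ℕ q +ℕ 1))   ≡⟨ cong (λ t → Nm γ * s + Tr (γ ^ q * t)) (^-2n+1 Y q) ⟩
          Nm γ * s + Tr (γ ^ q * (Y ^ q * Y ^ q * Y)) ≡⟨ cong (Nm γ * s +_) (Tr-conj-twisted γ Y) ⟩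
          Nm γ * s + Nm Y * Tr (γ * Y)                ≡⟨ cong (λ t → Nm γ * s + Nm t * Tr (γ * t)) (+-assoc s a (b * α)) ⟨
          Nm γ * s + Nm (y + b * α) * Tr (γ * (y + b * α))
            ≡⟨ cong₂ (λ N t → N * s + t) (Nm-coords c∈ d∈) (cong₂ _*_ (Nm-coords y∈ b∈) Tr-γY) ⟩
          (c * c + c * d + d * d * u) * s + (y * y + y * b + b * b * u) * (c * b + d * y + d * b)
            ≡⟨ solve 6 (λ s a b c d u →
                 (c :* c :+ c :* d :+ d :* d :* u) :* s
                   :+ ((s :+ a) :* (s :+ a) :+ (s :+ a) :* b :+ b :* b :* u) :* (c :* b :+ d :* (s :+ a) :+ d :* b)
                 := d :* (s :+ a) :* (s :+ a) :* (s :+ a) :+ b :* c :* (s :+ a) :* (s :+ a)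
                      :+ (b :* b :* (c :+ d :+ d :* u) :+ (c :* c :+ c :* d :+ d :* d :* u)) :* (s :+ a)
                    :+ ((c :* c :+ c :* d :+ d :* d :* u) :* a :+ b :* b :* u :* (c :* b :+ d :* b)))
                 refl s a b c d u ⟩
          cubic b c d y + ((c * c + c * d + d * d * u) * a + b * b * u * (c * b + d * b)) ∎
          where
          γ Y y : Carrier
          γ = c + d * α
          Y = s + (a + b * α)
          y = s + a
          y∈ : 𝔽q y
          y∈ = 𝔽q-+ s∈ a∈
          Tr-γY : Tr (γ * (y + b * α)) ≡ c * b + d * y + d * b
          Tr-γY = trans (cong Tr (*-coords c d y b))
            (Tr-coords (𝔽q-+ (𝔽q-* c∈ y∈) (𝔽q-* (𝔽q-* d∈ b∈) u∈)) (𝔽q-+ (𝔽q-+ (𝔽q-* c∈ b∈) (𝔽q-* d∈ y∈)) (𝔽q-* d∈ b∈)))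

        shiftedCoefficient : (b c d : Carrier) → Carrier
        shiftedCoefficient b c d = b * b * (c * c) + d * (b * b * (c + d + d * u) + c * c + c * d + d * d * u)

        Conditions : (b c d : Carrier) → Set
        Conditions b c d =
            (𝔽q (c + d * α) × (b ≡ 0# ⊎ b * b ≡ c + d * α))
          ⊎ (¬ 𝔽q (c + d * α) × c ≡ 0# × b * b * u + b * b + d * u ≡ 0# × m % 2 ≡ 1)
          ⊎ (¬ 𝔽q (c + d * α) × ¬ (c ≡ 0#) × shiftedCoefficient b c d ≡ 0# × m % 2 ≡ 1)

        Conditions-d≡0⇔ : ∀ {b c} → 𝔽q c → Conditions b c 0# ⇔ (b ≡ 0# ⊎ b * b ≡ c)
        Conditions-d≡0⇔ {b} {c} c∈ = mk⇔ outof into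
          where
          γ≡c : c + 0# * α ≡ c
          γ≡c = trans (cong (c +_) (zeroˡ α)) (+-identityʳ c)
          γ∈ : 𝔽q (c + 0# * α)
          γ∈ = subst 𝔽q (sym γ≡c) c∈
          into : b ≡ 0# ⊎ b * b ≡ c → Conditions b c 0#
          into b≡0⊎b²≡c = inj₁ (γ∈ , Sum.map₂ (λ b²≡c → trans b²≡c (sym γ≡c)) b≡0⊎b²≡c)
          outof : Conditions b c 0# → b ≡ 0# ⊎ b * b ≡ c
          outof (inj₁ (_ , b≡0⊎b²≡γ))  = Sum.map₂ (λ b²≡γ → trans b²≡γ γ≡c) b≡0⊎b²≡γ
          outof (inj₂ (inj₁ (γ∉ , _))) = contradiction γ∈ γ∉
          outof (inj₂ (inj₂ (γ∉ , _))) = contradiction γ∈ γ∉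

        Conditions-d≢0⇔ : ∀ {b c d} → 𝔽q c → 𝔽q d → d ≢ 0# →
                          Conditions b c d ⇔ (shiftedCoefficient b c d ≡ 0# × m % 2 ≡ 1)
        Conditions-d≢0⇔ {b} {c} {d} c∈ d∈ d≢0 = mk⇔ outof into
          where
          K0≡d²X : shiftedCoefficient b 0# d ≡ d * d * (b * b * u + b * b + d * u)
          K0≡d²X = solve 3 (λ b d u →
            b :* b :* (con false :* con false)
              :+ d :* (b :* b :* (con false :+ d :+ d :* u) :+ con false :* con false :+ con false :* d :+ d :* d :* u)
            := d :* d :* (b :* b :* u :+ b :* b :+ d :* u)) refl b d u
          γ∉ : ¬ 𝔽q (c + d * α)
          γ∉ γ∈ = d≢0 (trans (sym (Tr-coords c∈ d∈)) (𝔽q⇒Tr≡0 γ∈))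
          into : shiftedCoefficient b c d ≡ 0# × m % 2 ≡ 1 → Conditions b c d
          into (K≡0 , odd) with c ≟ 0#
          ... | yes c≡0 = inj₂ (inj₁ (γ∉ , c≡0 , X≡0 , odd))
            where X≡0 : b * b * u + b * b + d * u ≡ 0#
                  X≡0 = *≡0⇒≡0 (*-≢0 d≢0 d≢0)
                    (trans (sym K0≡d²X) (trans (cong (λ c → shiftedCoefficient b c d) (sym c≡0)) K≡0))
          ... | no c≢0  = inj₂ (inj₂ (γ∉ , c≢0 , K≡0 , odd))
          outof : Conditions b c d → shiftedCoefficient b c d ≡ 0# × m % 2 ≡ 1
          outof (inj₁ (γ∈ , _))                     = contradiction γ∈ γ∉
          outof (inj₂ (inj₁ (_ , c≡0 , X≡0 , odd))) =
            trans (cong (λ c → shiftedCoefficient b c d) c≡0) (trans K0≡d²X (trans (cong (d * d *_) X≡0) (zeroʳ _))) , odd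
          outof (inj₂ (inj₂ (_ , _ , K≡0 , odd)))   = K≡0 , odd

        cubic-injective⇔Conditions-d≡0 : ∀ {b c} → 𝔽q b → 𝔽q c → c + 0# * α ≢ 0# →
                                         InjectiveOn 𝔽q (cubic b c 0#) ⇔ Conditions b c 0#
        cubic-injective⇔Conditions-d≡0 {b} {c} b∈ c∈ γ≢0 =
          ⇔-trans (InjectiveOn-cong⇔ (λ {y} _ → quadratic-form y))
          (⇔-trans (InjectiveOn-*ˡ (λ y → b * y * y + (b * b + c) * y) c≢0)
          (⇔-trans (quadratic-injective⇔ b∈ c∈ c≢0) (⇔-sym (Conditions-d≡0⇔ c∈))))
          where
          c≢0 : c ≢ 0#
          c≢0 c≡0 = γ≢0 (trans (cong (c +_) (zeroˡ α)) (trans (+-identityʳ c) c≡0))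
          quadratic-form : ∀ y → cubic b c 0# y ≡ c * (b * y * y + (b * b + c) * y)
          quadratic-form = solve 4 (λ b c u y →
            con false :* y :* y :* y :+ b :* c :* y :* y
              :+ (b :* b :* (c :+ con false :+ con false :* u) :+ (c :* c :+ c :* con false :+ con false :* con false :* u)) :* y
            := c :* (b :* y :* y :+ (b :* b :+ c) :* y)) refl b c u

        cubic-injective⇔Conditions-d≢0 : ∀ {b c d} → 𝔽q b → 𝔽q c → 𝔽q d → d ≢ 0# → traceTo2 m u ≡ 1# →
                                         InjectiveOn 𝔽q (cubic b c d) ⇔ Conditions b c d
        cubic-injective⇔Conditions-d≢0 {b} {c} {d} b∈ c∈ d∈ d≢0 tr≡1 =
          ⇔-trans (cubic-shift⇔ d≢0 d∈ (𝔽q-* b∈ c∈))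
          (⇔-trans (InjectiveOn-cong⇔ (λ {r} _ → cong (λ k → r * r * r + k * r) shifted))
          (⇔-trans (cubic-injective⇔ u∈ tr≡1 K∈) (⇔-sym (Conditions-d≢0⇔ c∈ d∈ d≢0))))
          where
          shifted : b * c * (b * c) + d * (b * b * (c + d + d * u) + (c * c + c * d + d * d * u)) ≡ shiftedCoefficient b c d
          shifted = solve 4 (λ b c d u →
            b :* c :* (b :* c) :+ d :* (b :* b :* (c :+ d :+ d :* u) :+ (c :* c :+ c :* d :+ d :* d :* u))
            := b :* b :* (c :* c) :+ d :* (b :* b :* (c :+ d :+ d :* u) :+ c :* c :+ c :* d :+ d :* d :* u)) refl b c d u
          K∈ : 𝔽q (shiftedCoefficient b c d)
          K∈ = 𝔽q-+ (𝔽q-* b²∈ (𝔽q-* c∈ c∈)) (𝔽q-* d∈ (𝔽q-+ (𝔽q-+ (𝔽q-+ (𝔽q-* b²∈ (𝔽q-+ (𝔽q-+ c∈ d∈) (𝔽q-* d∈ u∈)))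
                 (𝔽q-* c∈ c∈)) (𝔽q-* c∈ d∈)) (𝔽q-* (𝔽q-* d∈ d∈) u∈)))
            where b²∈ : 𝔽q (b * b)
                  b²∈ = 𝔽q-* b∈ b∈

        cubic-injective⇔Conditions : ∀ {b c d} → 𝔽q b → 𝔽q c → 𝔽q d → c + d * α ≢ 0# → traceTo2 m u ≡ 1# →
                                     InjectiveOn 𝔽q (cubic b c d) ⇔ Conditions b c d
        cubic-injective⇔Conditions {d = d} b∈ c∈ d∈ γ≢0 tr≡1 with d ≟ 0#
        ... | yes refl = cubic-injective⇔Conditions-d≡0 b∈ c∈ γ≢0
        ... | no  d≢0  = cubic-injective⇔Conditions-d≢0 b∈ c∈ d∈ d≢0 tr≡1

theorem3p19 : (m : ℕ) → .{{_ : NonZero m}} → (F : FieldOfOrder ((2 ^ℕ m) ^ℕ 2)) →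
    let open FieldNotation F
        q = 2 ^ℕ m
    in (u α δ γ a b c d : Carrier) →
    InSubfield q u → traceTo2 m u ≡ 1# →
    α * α + α + u ≡ 0# →
    ¬ (γ ≡ 0#) →
    InSubfield q a → InSubfield q b → InSubfield q c → InSubfield q d →
    δ ≡ a + b * α → γ ≡ c + d * α →
    IsPermutation (λ x → (x ^ q + x + δ) ^ (2 *ℕ q +ℕ 1) + γ * x)
    ⇔ ( (InSubfield q γ × (b ≡ 0# ⊎ b * b ≡ γ))
      ⊎ (¬ InSubfield q γ × c ≡ 0# × b * b * u + b * b + d * u ≡ 0# × m % 2 ≡ 1)
      ⊎ (¬ InSubfield q γ × ¬ (c ≡ 0#)
          × b * b * (c * c) + d * (b * b * (c + d + d * u) + c * c + c * d + d * d * u) ≡ 0#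
          × m % 2 ≡ 1) )
theorem3p19 zero {{nz}} F = ⊥-elim-irr (NonZero.nonZero nz)
theorem3p19 (suc m′) F u α δ γ a b c d _ tr≡1 α²+α+u≡0 γ≢0 a∈ b∈ c∈ d∈ refl refl = begin
  IsPermutation f                                ∼⟨ IsPermutation⇔Injective f ⟩
  Injective _≡_ _≡_ f                            ∼⟨ Reduction.Injective⇔InjectiveOn-𝔽q H γ≢0 ⟩
  InjectiveOn 𝔽q G                               ∼⟨ InjectiveOn-cong⇔ (G≡cubic a∈ b∈ c∈ d∈) ⟩
  InjectiveOn 𝔽q (λ s → cubic b c d (s + a) + κ) ∼⟨ InjectiveOn-+ʳ (λ s → cubic b c d (s + a)) κ ⟩
  InjectiveOn 𝔽q (λ s → cubic b c d (s + a))     ∼⟨ InjectiveOn-∘+ (cubic b c d) a∈ ⟩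
  InjectiveOn 𝔽q (cubic b c d)                   ∼⟨ cubic-injective⇔Conditions b∈ c∈ d∈ γ≢0 tr≡1 ⟩
  Conditions b c d                               ∎
  where
  open FieldNotation F
  open FieldProperties field'
  open FiniteField F
  1+1≡0 : 1# + 1# ≡ 0#
  1+1≡0 = evenOrder⇒1+1≡0 (2 ^ℕ m′ *ℕ (2 ^ℕ suc m′) ^ℕ 1) (ℕ.*-assoc 2 (2 ^ℕ m′) ((2 ^ℕ suc m′) ^ℕ 1))
  open CharacteristicTwo field' 1+1≡0
  open CharacteristicTwoFiniteField F 1+1≡0
  open Subfield m′
  open QuadraticExtension (^-involutive q (cong (q *ℕ_) (ℕ.*-identityʳ q)))
  α²+α≡u : α * α + α ≡ u
  α²+α≡u = +≡0⇒≡ α²+α+u≡0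
  open Basis α²+α≡u (trans (root-^2^k α²+α≡u m) (cong (α +_) tr≡1))
  open Related.EquationalReasoning
  H f G : Carrier → Carrier
  H t = (t + (a + b * α)) ^ (2 *ℕ q +ℕ 1)
  f x = H (Tr x) + (c + d * α) * x
  G s = Nm (c + d * α) * s + Tr ((c + d * α) ^ q * H s)
  κ : Carrier
  κ = (c * c + c * d + d * d * u) * a + b * b * u * (c * b + d * b)
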